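{- Let $G$ be a finite simple graph with exactly two holes $C_1$ and $C_2$. If $C_1$ and $C_2$ have a common edge, then the subgraph of $G$ induced by the edge set $E(C_1)\cap E(C_2)$ (i.e. consisting of these edges and their endpoints) is a path.
   Context: A hole of a graph is an induced subgraph that is a cycle of length at least $4$. -}

module Defs where

open import Data.Nat using (ℕ; zero; suc; _+_; _%_)
open import Data.Fin using (Fin; toℕ; inject₁) renaming (suc to fsuc)
open import Data.Fin.Subset using (Subset; _∈_)
open import Data.Bool using (Bool; true)
open import Data.Product using (Σ; ∃; ∃-syntax; _×_; _,_)
open import Data.Sum using (_⊎_)
open import Relation.Binary.PropositionalEquality using (_≡_; _≢_)
open import Function.Bundles using (_⇔_)
open import Function.Definitions using (Injective)
open import Relation.Nullary using (¬_)
open import Data.Empty using (⊥)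

record Graph (n : ℕ) : Set where
  field
    adj       : Fin n → Fin n → Bool
    adj-sym   : ∀ u v → adj u v ≡ adj v u
    adj-irrefl : ∀ v → adj v v ≡ true → ⊥
  Adj : Fin n → Fin n → Set
  Adj u v = adj u v ≡ true
open Graph public

CycSucc : (k : ℕ) → Fin (4 + k) → Fin (4 + k) → Set
CycSucc k i j = toℕ j ≡ suc (toℕ i) % (4 + k)

CycAdj : (k : ℕ) → Fin (4 + k) → Fin (4 + k) → Set
CycAdj k i j = CycSucc k i j ⊎ CycSucc k j i

-- S ⊆ V(G) is a hole: the subgraph of G induced by S is a cycle of length ≥ 4,
-- i.e. S = {c 0, ..., c (m-1)} (c injective, m = 4 + k) and, for vertices of S,
-- adjacency in G is exactly cyclic consecutiveness.
IsHole : ∀ {n} → Graph n → Subset n → Set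
IsHole {n} G S =
  Σ ℕ λ k → Σ (Fin (4 + k) → Fin n) λ c →
    Injective _≡_ _≡_ c ×
    (∀ x → (x ∈ S) ⇔ (∃[ i ] c i ≡ x)) ×
    (∀ i j → Adj G (c i) (c j) ⇔ CycAdj k i j)

ExactlyTwoHoles : ∀ {n} → Graph n → Subset n → Subset n → Set
ExactlyTwoHoles G C₁ C₂ =
  C₁ ≢ C₂ × IsHole G C₁ × IsHole G C₂ ×
  (∀ S → IsHole G S → S ≡ C₁ ⊎ S ≡ C₂)

EdgeOf : ∀ {n} → Graph n → Subset n → Fin n → Fin n → Set
EdgeOf G C u v = Adj G u v × u ∈ C × v ∈ C

CommonEdge : ∀ {n} → Graph n → Subset n → Subset n → Fin n → Fin n → Set
CommonEdge G C₁ C₂ u v = EdgeOf G C₁ u v × EdgeOf G C₂ u v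

IsPath : ∀ {n} → (Fin n → Set) → (Fin n → Fin n → Set) → Set
IsPath {n} V E =
  Σ ℕ λ m → Σ (Fin (suc m) → Fin n) λ p →
    Injective _≡_ _≡_ p ×
    (∀ x → V x ⇔ (∃[ i ] p i ≡ x)) ×
    (∀ x y → E x y ⇔ (∃[ i ] ((p (inject₁ i) ≡ x × p (fsuc i) ≡ y)
                             ⊎ (p (inject₁ i) ≡ y × p (fsuc i) ≡ x))))

CommonVertex : ∀ {n} → Graph n → Subset n → Subset n → Fin n → Set
CommonVertex G C₁ C₂ u = ∃[ v ] CommonEdge G C₁ C₂ u v

module Submission where

-- Read each hole as a periodic vertex sequence. Since neither hole contains the other, a
-- common edge extends to a maximal run c 0, …, c r of common edges of the first hole, and the
-- second hole, read from the same edge, follows it along the run. These are all the common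
-- vertices: from any other one, going back to c r along the first hole and on to c 0 along the
-- second gives a detour whose induced sub-walk, closed up through c 0, …, c r, is a third hole,
-- as it misses the last vertex of the first hole and the vertex of the second after the run.

open import Defs
open import Data.Nat
open import Data.Nat.Properties
open import Data.Nat.DivMod
open import Data.Nat.Tactic.RingSolver using (solve-∀)
open import Data.Product
open import Data.Sum
open import Data.Empty
open import Data.Bool using (true; false)
open import Data.Fin as F using (Fin; toℕ; fromℕ<; inject₁) renaming (suc to fsuc)
open import Data.Fin.Properties using (toℕ-injective; toℕ-fromℕ<; toℕ<n; toℕ-inject₁; any?)
open import Data.Fin.Subset using (Subset; _∈_; _∉_; _⊆_)
open import Data.Fin.Subset.Properties using (⊆-antisym; _∈?_)
open import Function.Bundles using (_⇔_; mk⇔; Equivalence)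
open import Function using (_∘_)
open import Relation.Nullary
open import Relation.Nullary.Decidable using (_×-dec_; _⊎-dec_; dec-true; decidable-stable)
open import Data.Vec using (tabulate; lookup)
open import Data.Vec.Properties using (lookup∘tabulate; []=⇒lookup; lookup⇒[]=)
open import Relation.Binary.Definitions using (tri<; tri≈; tri>)
open import Relation.Binary.PropositionalEquality
open import Relation.Binary.Bundles using (Setoid)
import Relation.Binary.Reasoning.Setoid as SetoidReasoning

-- Congruence modulo suc p; holes of length 4 + k use p = 3 + k.
module Congruence (p : ℕ) where

  infix 4 _≋_
  record _≋_ (a b : ℕ) : Set where
    constructor mk≋
    field un≋ : a % suc p ≡ b % suc p
  open _≋_ public

  ≋-reflexive : ∀ {a b} → a ≡ b → a ≋ b
  ≋-reflexive refl = mk≋ refl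

  ≋-sym : ∀ {a b} → a ≋ b → b ≋ a
  ≋-sym (mk≋ e) = mk≋ (sym e)

  ≋-trans : ∀ {a b c} → a ≋ b → b ≋ c → a ≋ c
  ≋-trans (mk≋ e) (mk≋ f) = mk≋ (trans e f)

  ≋-setoid : Setoid _ _
  ≋-setoid = record
    { _≈_ = _≋_
    ; isEquivalence = record { refl = mk≋ refl ; sym = ≋-sym ; trans = ≋-trans } }

  module ≋-Reasoning = SetoidReasoning ≋-setoid

  %-≋ : ∀ a → a % suc p ≋ a
  %-≋ a = mk≋ (m%n%n≡m%n a (suc p))

  +-kL-≋ : ∀ a q → a + q * suc p ≋ a
  +-kL-≋ a q = mk≋ ([m+kn]%n≡m%n a q (suc p))

  +-L-≋ : ∀ a → a + suc p ≋ a
  +-L-≋ a = mk≋ ([m+n]%n≡m%n a (suc p))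

  +-congʳ-≋ : ∀ {a b} t → a ≋ b → a + t ≋ b + t
  +-congʳ-≋ {a} {b} t (mk≋ e) = mk≋ (begin
    (a + t) % suc p                   ≡⟨ %-distribˡ-+ a t (suc p) ⟩
    (a % suc p + t % suc p) % suc p   ≡⟨ cong (λ z → (z + t % suc p) % suc p) e ⟩
    (b % suc p + t % suc p) % suc p   ≡⟨ %-distribˡ-+ b t (suc p) ⟨
    (b + t) % suc p                   ∎)
    where open ≡-Reasoning

  +-congˡ-≋ : ∀ {a b} t → a ≋ b → t + a ≋ t + b
  +-congˡ-≋ {a} {b} t e rewrite +-comm t a | +-comm t b = +-congʳ-≋ t e

  *-congˡ-≋ : ∀ {a b} t → a ≋ b → t * a ≋ t * b
  *-congˡ-≋ {a} {b} t (mk≋ e) = mk≋ (begin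
    (t * a) % suc p                   ≡⟨ %-distribˡ-* t a (suc p) ⟩
    (t % suc p * (a % suc p)) % suc p ≡⟨ cong (λ z → (t % suc p * z) % suc p) e ⟩
    (t % suc p * (b % suc p)) % suc p ≡⟨ %-distribˡ-* t b (suc p) ⟨
    (t * b) % suc p                   ∎)
    where open ≡-Reasoning

  ≋⇒≡ : ∀ {a b} → a < suc p → b < suc p → a ≋ b → a ≡ b
  ≋⇒≡ a<L b<L (mk≋ e) = trans (sym (m<n⇒m%n≡m a<L)) (trans e (m<n⇒m%n≡m b<L))

  ≋⇒≡⊎wrap : ∀ {a b} → a < suc p → b ≤ suc p → a ≋ b → a ≡ b ⊎ (a ≡ 0 × b ≡ suc p)
  ≋⇒≡⊎wrap a<L b≤L e with m≤n⇒m<n∨m≡n b≤L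
  ... | inj₁ b<L = inj₁ (≋⇒≡ a<L b<L e)
  ... | inj₂ refl = inj₂ (trans (sym (m<n⇒m%n≡m a<L)) (trans (un≋ e) (n%n≡0 (suc p))) , refl)

  *L-≋0 : ∀ q → q * suc p ≋ 0
  *L-≋0 q = mk≋ (m*n%n≡0 q (suc p))

  -- adding p * t turns t into the multiple t * suc p
  +-cancelˡ-≋ : ∀ {a b} t → t + a ≋ t + b → a ≋ b
  +-cancelˡ-≋ {a} {b} t e = ≋-trans (≋-sym (+-kL-≋ a t)) (≋-trans
    (subst₂ _≋_ (absorb p t a) (absorb p t b) (+-congʳ-≋ (p * t) e)) (+-kL-≋ b t))
    where
      absorb : ∀ p t x → (t + x) + p * t ≡ x + t * suc p
      absorb = solve-∀

  neg : ℕ → ℕ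
  neg x = p * x

  neg-involutive : ∀ x → neg (neg x) ≋ x
  neg-involutive x = +-cancelˡ-≋ (neg x)
    (subst₂ _≋_ (sym (sum₁ p x)) (sym (sum₂ p x)) (≋-trans (*L-≋0 (neg x)) (≋-sym (*L-≋0 x))))
    where
      sum₁ : ∀ p x → p * x + p * (p * x) ≡ (p * x) * suc p
      sum₁ = solve-∀
      sum₂ : ∀ p x → p * x + x ≡ x * suc p
      sum₂ = solve-∀

  neg-cancel-≋ : ∀ {a b} → neg a ≋ neg b → a ≋ b
  neg-cancel-≋ {a} {b} e = ≋-trans (≋-sym (neg-involutive a)) (≋-trans (*-congˡ-≋ p e) (neg-involutive b))

  suc-neg-suc : ∀ i → suc (neg (suc i)) ≋ neg i
  suc-neg-suc i = subst (_≋ neg i) (cong suc (sym (*-suc p i))) (subst (_≋ neg i) (+-comm (neg i) (suc p)) (+-L-≋ (neg i)))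

  neg-suc : ∀ {a b} → neg a ≋ suc (neg b) → b ≋ suc a
  neg-suc {a} {b} e = ≋-sym (begin
    suc a              ≈⟨ +-congˡ-≋ 1 (≋-sym (neg-involutive a)) ⟩
    suc (neg (neg a))  ≈⟨ +-congˡ-≋ 1 (*-congˡ-≋ p e) ⟩
    suc (p * suc (neg b)) ≡⟨ cong suc (*-suc p (neg b)) ⟩
    suc p + neg (neg b) ≈⟨ +-congˡ-≋ (suc p) (neg-involutive b) ⟩
    suc p + b          ≡⟨ +-comm (suc p) b ⟩
    b + suc p          ≈⟨ +-L-≋ b ⟩
    b                  ∎)
    where open ≋-Reasoning

  +-injective-≋ : ∀ t {a b} → a < suc p → b < suc p → t + a ≋ t + b → a ≡ b
  +-injective-≋ t a<L b<L e = ≋⇒≡ a<L b<L (+-cancelˡ-≋ t e)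

  suc≉pred : 2 ≤ p → ∀ i → ¬ suc i ≋ i + p
  suc≉pred 2≤p i e = <⇒≢ 2≤p (+-injective-≋ i (s≤s (<⇒≤ 2≤p)) ≤-refl (subst (_≋ i + p) (+-comm 1 i) e))

  suc-suc≉ : 2 ≤ p → ∀ i → ¬ 2 + i ≋ i
  suc-suc≉ 2≤p i e with +-injective-≋ i (s≤s 2≤p) (s≤s z≤n) (subst₂ _≋_ (+-comm 2 i) (sym (+-identityʳ i)) e)
  ... | ()

  +-neg-≋ : ∀ s i → s + (neg s + i) ≋ i
  +-neg-≋ s i = subst (_≋ i) (sym (eq p s i)) (+-kL-≋ i s)
    where
      eq : ∀ p s i → s + (p * s + i) ≡ i + s * suc p
      eq = solve-∀

  suc-+p-≋ : ∀ i → suc (i + p) ≋ i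
  suc-+p-≋ i = subst (_≋ i) (+-suc i p) (+-L-≋ i)

  ≋suc⇒+p : ∀ {i j} → i ≋ suc j → j ≋ i + p
  ≋suc⇒+p {i} {j} e = ≋-sym (≋-trans (+-congʳ-≋ p e) (suc-+p-≋ j))

find-least : (P : ℕ → Set) → (∀ i → Dec (P i)) → (N : ℕ) →
             (∃ λ i → i < N × P i × (∀ j → j < i → ¬ P j)) ⊎ (∀ i → i < N → ¬ P i)
find-least P P? zero = inj₂ (λ i ())
find-least P P? (suc N) with find-least P P? N
... | inj₁ (i , i<N , Pi , least) = inj₁ (i , m≤n⇒m≤1+n i<N , Pi , least)
... | inj₂ none with P? N
... | yes PN = inj₁ (N , ≤-refl , PN , none)
... | no ¬PN = inj₂ λ i i<1+N → [ none i , (λ { refl → ¬PN }) ]′ (m≤n⇒m<n∨m≡n (≤-pred i<1+N))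

least-witness : (P : ℕ → Set) → (∀ i → Dec (P i)) → ∀ N → P N →
                ∃ λ i → i ≤ N × P i × (∀ j → j < i → ¬ P j)
least-witness P P? N PN with find-least P P? (suc N)
... | inj₁ (i , i<1+N , Pi , least) = i , ≤-pred i<1+N , Pi , least
... | inj₂ none = ⊥-elim (none N ≤-refl PN)

rise : (P : ℕ → Set) → (∀ i → Dec (P i)) → ∀ {x y} → x < y → ¬ P x → P y → ∃ λ s → ¬ P s × P (suc s)
rise P P? {x} {y} x<y ¬Px Py with least-witness (λ u → P (suc x + u)) (λ u → P? (suc x + u)) (y ∸ suc x)
                                     (subst P (sym (m+[n∸m]≡n x<y)) Py)
... | zero  , _ , P[1+x+0] , _     = x , ¬Px , subst P (cong suc (+-identityʳ x)) P[1+x+0]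
... | suc u , _ , P[1+x+1+u] , least = suc x + u , least u ≤-refl , subst P (+-suc (suc x) u) P[1+x+1+u]

first-failure : (P : ℕ → Set) → (∀ i → Dec (P i)) → ∀ {y} → P 0 → ¬ P y →
                ∃ λ r → (∀ q → q ≤ r → P q) × ¬ P (suc r)
first-failure P P? {y} P0 ¬Py with least-witness (¬_ ∘ P) (¬? ∘ P?) y ¬Py
... | zero  , _ , ¬P0 , _     = ⊥-elim (¬P0 P0)
... | suc r , _ , ¬P1+r , least = r , (λ q q≤r → decidable-stable (P? q) (least q (s≤s q≤r))) , ¬P1+r

Adj-sym : ∀ {n} (G : Graph n) {u v} → Adj G u v → Adj G v u
Adj-sym G {u} {v} uv = trans (adj-sym G v u) uv

Adj⇒≢ : ∀ {n} (G : Graph n) {u v} → Adj G u v → u ≢ v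
Adj⇒≢ G {u} uu refl = adj-irrefl G u uu

Adj? : ∀ {n} (G : Graph n) u v → Dec (Adj G u v)
Adj? G u v with adj G u v
... | true  = yes refl
... | false = no λ ()

decidable-subset : ∀ {n} {P : Fin n → Set} → (∀ x → Dec (P x)) → Σ (Subset n) λ S → ∀ x → x ∈ S ⇔ P x
decidable-subset {n} {P} P? = S , λ x → mk⇔ (to x) (from x)
  where
    S : Subset n
    S = tabulate (does ∘ P?)
    lookup-S : ∀ x → lookup S x ≡ does (P? x)
    lookup-S = lookup∘tabulate (does ∘ P?)
    to : ∀ x → x ∈ S → P x
    to x x∈S with P? x | trans (sym (lookup-S x)) ([]=⇒lookup x∈S)
    ... | yes Px | _ = Px
    ... | no _   | ()
    from : ∀ x → P x → x ∈ S
    from x Px = lookup⇒[]= x S (trans (lookup-S x) (dec-true (P? x) Px))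

image : ∀ {n L} (c : Fin L → Fin n) → Σ (Subset n) λ S → ∀ x → x ∈ S ⇔ ∃ λ I → c I ≡ x
image c = decidable-subset λ x → any? λ I → c I F.≟ x

module Walks {n} (G : Graph n) (a b : Fin n) (a≢b : a ≢ b) (V : Fin n → Set) where

  record Walk : Set where
    field
      len           : ℕ
      W             : ℕ → Fin n
      2≤len         : 2 ≤ len
      W0≡b          : W 0 ≡ b
      Wlen≡a        : W len ≡ a
      W-adj         : ∀ t → t < len → Adj G (W t) (W (suc t))
      W∈V           : ∀ t → t ≤ len → V (W t)
      interior≢ends : ∀ t → 0 < t → t < len → W t ≢ a × W t ≢ b

  -- a and b may be adjacent, so the pair (0, len) is exempt.
  record Induced (w : Walk) : Set where
    open Walk w
    field
      W-injective : ∀ t t' → t ≤ len → t' ≤ len → W t ≡ W t' → t ≡ t'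
      chordless   : ∀ t t' → t' ≤ len → t < t' → Adj G (W t) (W t') → t' ≡ suc t ⊎ (t ≡ 0 × t' ≡ len)

  module _ (w : Walk) where
    open Walk w

    bypass : ∀ i d len' → len ≡ len' + d → i < len' → 2 ≤ len' →
             Adj G (W i) (W (i + suc d)) → Walk
    bypass i d len' len≡ i<len' 2≤len' Wi~W = record
      { len = len' ; W = W' ; 2≤len = 2≤len' ; W0≡b = W0≡b ; Wlen≡a = Wlen'≡a
      ; W-adj = W'-adj ; W∈V = W'∈V ; interior≢ends = W'-interior }
      where
        W' : ℕ → Fin n
        W' t with t ≤? i
        ... | yes _ = W t
        ... | no  _ = W (t + d)
        len'≤len : len' ≤ len
        len'≤len = subst (len' ≤_) (sym len≡) (m≤m+n len' d)
        shift< : ∀ t → t < len' → t + d < len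
        shift< t t<len' = subst (t + d <_) (sym len≡) (+-monoˡ-< d t<len')
        Wlen'≡a : W' len' ≡ a
        Wlen'≡a with len' ≤? i
        ... | yes len'≤i = ⊥-elim (<⇒≱ i<len' len'≤i)
        ... | no  _      = trans (cong W (sym len≡)) Wlen≡a
        W'-adj : ∀ t → t < len' → Adj G (W' t) (W' (suc t))
        W'-adj t t<len' with t ≤? i | suc t ≤? i
        ... | yes _   | yes t<i = W-adj t (<-≤-trans t<i (≤-trans (<⇒≤ i<len') len'≤len))
        ... | no t≰i  | yes t<i = ⊥-elim (t≰i (≤-trans (n≤1+n t) t<i))
        ... | no _    | no _    = W-adj (t + d) (shift< t t<len')
        ... | yes t≤i | no t≮i with ≤-antisym t≤i (≤-pred (≰⇒> t≮i))
        ...   | refl = subst (λ z → Adj G (W t) (W z)) (+-suc t d) Wi~W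
        W'∈V : ∀ t → t ≤ len' → V (W' t)
        W'∈V t t≤len' with t ≤? i
        ... | yes _ = W∈V t (≤-trans t≤len' len'≤len)
        ... | no  _ = W∈V (t + d) (subst (t + d ≤_) (sym len≡) (+-monoˡ-≤ d t≤len'))
        W'-interior : ∀ t → 0 < t → t < len' → W' t ≢ a × W' t ≢ b
        W'-interior t 0<t t<len' with t ≤? i
        ... | yes _ = interior≢ends t 0<t (<-≤-trans t<len' len'≤len)
        ... | no  _ = interior≢ends (t + d) (<-≤-trans 0<t (m≤m+n t d)) (shift< t t<len')

    skip-over : ∀ i d → 0 < d → i + suc d ≤ len → 2 + d ≤ len →
                Adj G (W i) (W (i + suc d)) → Σ Walk λ w' → Walk.len w' < len
    skip-over i d 0<d i+1+d≤len 2+d≤len Wi~W =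
      bypass i d (len ∸ d) (sym (m∸n+n≡m d≤len)) i<len' (m+n≤o⇒m≤o∸n 2 2+d≤len) Wi~W ,
      ∸-monoʳ-< 0<d d≤len
      where
        d≤len : d ≤ len
        d≤len = ≤-trans (m≤n+m d i) (≤-trans (+-monoʳ-≤ i (n≤1+n d)) i+1+d≤len)
        i<len' : i < len ∸ d
        i<len' = m+n≤o⇒m≤o∸n (suc i) (subst (_≤ len) (+-suc i d) i+1+d≤len)

    Shortcut : ℕ → ℕ → Set
    Shortcut t t' = W t ≡ W t' ⊎ (Adj G (W t) (W t') × suc t < t' × ¬ (t ≡ 0 × t' ≡ len))

    shortcut? : ∀ t t' → Dec (Shortcut t t')
    shortcut? t t' = (W t F.≟ W t') ⊎-dec (Adj? G (W t) (W t') ×-dec (suc t <? t' ×-dec ¬? (t ≟ 0 ×-dec t' ≟ len)))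

    ShortcutTo : ℕ → Set
    ShortcutTo t' = ∃ λ t → t < t' × Shortcut t t'

    shortcutTo? : ∀ t' → Dec (ShortcutTo t')
    shortcutTo? t' with find-least (λ t → Shortcut t t') (λ t → shortcut? t t') t'
    ... | inj₁ (t , t<t' , sc , _) = yes (t , t<t' , sc)
    ... | inj₂ none = no λ (t , t<t' , sc) → none t t<t' sc

    shortcut⇒shorter : ∀ t' → t' ≤ len → ShortcutTo t' → Σ Walk λ w' → Walk.len w' < len
    shortcut⇒shorter t' t'≤len (t , t<t' , inj₁ Wt≡Wt') =
      skip-over t (t' ∸ t) (m<n⇒0<n∸m t<t') t+1+d≤len 2+d≤len
        (subst (λ z → Adj G (W t) (W z)) t'+1≡ (subst (λ z → Adj G z (W (suc t'))) (sym Wt≡Wt') (W-adj t' t'<len)))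
      where
        t'+1≡ : suc t' ≡ t + suc (t' ∸ t)
        t'+1≡ = trans (cong suc (sym (m+[n∸m]≡n (<⇒≤ t<t')))) (sym (+-suc t _))
        t'<len : t' < len
        t'<len with m≤n⇒m<n∨m≡n t'≤len | t ≟ 0
        ... | inj₁ t'<len | _       = t'<len
        ... | inj₂ refl   | yes refl = ⊥-elim (a≢b (trans (sym Wlen≡a) (trans (sym Wt≡Wt') W0≡b)))
        ... | inj₂ refl   | no t≢0  = ⊥-elim (proj₁ (interior≢ends t (n≢0⇒n>0 t≢0) t<t') (trans Wt≡Wt' Wlen≡a))
        0<t : 0 < t
        0<t with t ≟ 0
        ... | yes refl = ⊥-elim (proj₂ (interior≢ends t' t<t' t'<len) (trans (sym Wt≡Wt') W0≡b))
        ... | no t≢0  = n≢0⇒n>0 t≢0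
        t+1+d≤len : t + suc (t' ∸ t) ≤ len
        t+1+d≤len = subst (_≤ len) t'+1≡ t'<len
        2+d≤len : 2 + (t' ∸ t) ≤ len
        2+d≤len = ≤-trans (+-monoˡ-≤ (t' ∸ t) (s≤s 0<t)) (subst (_≤ len) (cong suc (sym (m+[n∸m]≡n (<⇒≤ t<t')))) t'<len)
    shortcut⇒shorter t' t'≤len (t , t<t' , inj₂ (Wt~Wt' , 1+t<t' , ¬0-len)) =
      skip-over t (t' ∸ suc t) (m<n⇒0<n∸m 1+t<t') (subst (_≤ len) (sym t'≡) t'≤len) 2+d≤len
        (subst (λ z → Adj G (W t) (W z)) (sym t'≡) Wt~Wt')
      where
        1+t+d≡t' : suc t + (t' ∸ suc t) ≡ t'
        1+t+d≡t' = m+[n∸m]≡n (<⇒≤ 1+t<t')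
        t'≡ : t + suc (t' ∸ suc t) ≡ t'
        t'≡ = trans (+-suc t _) 1+t+d≡t'
        2+d≤len : 2 + (t' ∸ suc t) ≤ len
        2+d≤len with t ≟ 0 | m≤n⇒m<n∨m≡n t'≤len
        ... | no t≢0  | _           = ≤-trans (+-monoˡ-≤ (t' ∸ suc t) (s≤s (n≢0⇒n>0 t≢0))) (subst (_≤ len) (sym 1+t+d≡t') t'≤len)
        ... | yes refl | inj₁ t'<len = subst (_≤ len) (cong suc (sym 1+t+d≡t')) t'<len
        ... | yes refl | inj₂ t'≡len = ⊥-elim (¬0-len (refl , t'≡len))

    no-shortcut⇒induced : (∀ t' → t' < suc len → ¬ ShortcutTo t') → Induced w
    no-shortcut⇒induced none = record { W-injective = W-injective ; chordless = chordless }
      where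
        W-injective : ∀ t t' → t ≤ len → t' ≤ len → W t ≡ W t' → t ≡ t'
        W-injective t t' t≤len t'≤len e with <-cmp t t'
        ... | tri< t<t' _ _ = ⊥-elim (none t' (s≤s t'≤len) (t , t<t' , inj₁ e))
        ... | tri≈ _ t≡t' _ = t≡t'
        ... | tri> _ _ t'<t = ⊥-elim (none t (s≤s t≤len) (t' , t'<t , inj₁ (sym e)))
        chordless : ∀ t t' → t' ≤ len → t < t' → Adj G (W t) (W t') → t' ≡ suc t ⊎ (t ≡ 0 × t' ≡ len)
        chordless t t' t'≤len t<t' Wt~Wt' with suc t ≟ t' | t ≟ 0 ×-dec t' ≟ len
        ... | yes 1+t≡t' | _ = inj₁ (sym 1+t≡t')
        ... | no _ | yes 0-len = inj₂ 0-len
        ... | no 1+t≢t' | no ¬0-len = ⊥-elim (none t' (s≤s t'≤len) (t , t<t' , inj₂ (Wt~Wt' , ≤∧≢⇒< t<t' 1+t≢t' , ¬0-len)))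

  induced-subwalk : Walk → Σ Walk Induced
  induced-subwalk w = shorten (Walk.len w) w ≤-refl
    where
      shorten : (fuel : ℕ) → (w : Walk) → Walk.len w ≤ fuel → Σ Walk Induced
      shorten zero w len≤0 = ⊥-elim (<⇒≱ (≤-trans (s≤s z≤n) (Walk.2≤len w)) len≤0)
      shorten (suc fuel) w len≤fuel with find-least (ShortcutTo w) (shortcutTo? w) (suc (Walk.len w))
      ... | inj₂ none = w , no-shortcut⇒induced w none
      ... | inj₁ (t' , t'<1+len , sc , _) =
        let (w' , shorter) = shortcut⇒shorter w t' (≤-pred t'<1+len) sc
        in shorten fuel w' (≤-pred (≤-trans shorter len≤fuel))

≡suc%⇒ : ∀ {L x y} .{{_ : NonZero L}} → x < L → y ≡ suc x % L → y ≡ suc x ⊎ (y ≡ 0 × suc x ≡ L)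
≡suc%⇒ {L} x<L e with m≤n⇒m<n∨m≡n x<L
... | inj₁ 1+x<L = inj₁ (trans e (m<n⇒m%n≡m 1+x<L))
... | inj₂ 1+x≡L = inj₂ (trans e (trans (cong (_% L) 1+x≡L) (n%n≡0 L)) , 1+x≡L)

⇒≡suc% : ∀ {L x y} .{{_ : NonZero L}} → x < L → y < L → y ≡ suc x ⊎ (y ≡ 0 × suc x ≡ L) → y ≡ suc x % L
⇒≡suc% {L} x<L y<L (inj₁ y≡1+x) with m≤n⇒m<n∨m≡n x<L
... | inj₁ 1+x<L = trans y≡1+x (sym (m<n⇒m%n≡m 1+x<L))
... | inj₂ 1+x≡L = ⊥-elim (<-irrefl (trans y≡1+x 1+x≡L) y<L)
⇒≡suc% {L} x<L y<L (inj₂ (y≡0 , 1+x≡L)) = trans y≡0 (sym (trans (cong (_% L) 1+x≡L) (n%n≡0 L)))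

record IsInducedCycle {n} (G : Graph n) (N : ℕ) (h : ℕ → Fin n) : Set where
  field
    4≤N       : 4 ≤ N
    injective : ∀ t t' → t < N → t' < N → h t ≡ h t' → t ≡ t'
    chordless : ∀ t t' → t < t' → t' < N → Adj G (h t) (h t') → t' ≡ suc t ⊎ (t ≡ 0 × suc t' ≡ N)
    adj-suc   : ∀ t → suc t < N → Adj G (h t) (h (suc t))
    adj-wrap  : ∀ t → suc t ≡ N → Adj G (h t) (h 0)

induced-cycle⇒hole : ∀ {n} {G : Graph n} {N h} → IsInducedCycle G N h →
                     Σ (Subset n) λ U → IsHole G U × (∀ x → x ∈ U → ∃ λ t → t < N × h t ≡ x)
induced-cycle⇒hole {n} {G} {N} {h} cyc = U , (k , c′ , c′-injective , U⇔ , c′-adj) , U⇒h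
  where
    open IsInducedCycle cyc
    k : ℕ
    k = N ∸ 4
    4+k≡N : 4 + k ≡ N
    4+k≡N = m+[n∸m]≡n 4≤N
    c′ : Fin (4 + k) → Fin n
    c′ I = h (toℕ I)
    toℕ<N : ∀ (I : Fin (4 + k)) → toℕ I < N
    toℕ<N I = subst (toℕ I <_) 4+k≡N (toℕ<n I)
    U : Subset n
    U = proj₁ (image c′)
    U⇔ : ∀ x → x ∈ U ⇔ ∃ λ I → c′ I ≡ x
    U⇔ = proj₂ (image c′)
    U⇒h : ∀ x → x ∈ U → ∃ λ t → t < N × h t ≡ x
    U⇒h x x∈U = let (I , e) = Equivalence.to (U⇔ x) x∈U in toℕ I , toℕ<N I , e
    c′-injective : ∀ {I J} → c′ I ≡ c′ J → I ≡ J
    c′-injective {I} {J} e = toℕ-injective (injective _ _ (toℕ<N I) (toℕ<N J) e)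
    wrap : ∀ {I J} → toℕ J ≡ 0 × suc (toℕ I) ≡ N → toℕ J ≡ 0 × suc (toℕ I) ≡ 4 + k
    wrap (J≡0 , 1+I≡N) = J≡0 , trans 1+I≡N (sym 4+k≡N)
    adj⇒cyc : ∀ I J → Adj G (c′ I) (c′ J) → CycAdj k I J
    adj⇒cyc I J cI~cJ with <-cmp (toℕ I) (toℕ J)
    ... | tri< I<J _ _ = [ (λ e → inj₁ (⇒≡suc% (toℕ<n I) (toℕ<n J) (inj₁ e))) ,
                           (λ w → inj₂ (⇒≡suc% (toℕ<n J) (toℕ<n I) (inj₂ (wrap w)))) ]′
                         (chordless _ _ I<J (toℕ<N J) cI~cJ)
    ... | tri≈ _ I≡J _ = ⊥-elim (Adj⇒≢ G cI~cJ (cong c′ (toℕ-injective I≡J)))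
    ... | tri> _ _ J<I = [ (λ e → inj₂ (⇒≡suc% (toℕ<n J) (toℕ<n I) (inj₁ e))) ,
                           (λ w → inj₁ (⇒≡suc% (toℕ<n I) (toℕ<n J) (inj₂ (wrap w)))) ]′
                         (chordless _ _ J<I (toℕ<N I) (Adj-sym G cI~cJ))
    succ⇒adj : ∀ I J → CycSucc k I J → Adj G (c′ I) (c′ J)
    succ⇒adj I J J≡ with ≡suc%⇒ (toℕ<n I) J≡
    ... | inj₁ e = subst (λ z → Adj G (c′ I) (h z)) (sym e) (adj-suc (toℕ I) (subst (_< N) e (toℕ<N J)))
    ... | inj₂ (J≡0 , 1+I≡L) = subst (λ z → Adj G (c′ I) (h z)) (sym J≡0) (adj-wrap (toℕ I) (trans 1+I≡L 4+k≡N))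
    c′-adj : ∀ I J → Adj G (c′ I) (c′ J) ⇔ CycAdj k I J
    c′-adj I J = mk⇔ (adj⇒cyc I J) [ succ⇒adj I J , (λ s → Adj-sym G (succ⇒adj J I s)) ]′

infix 4 _≋⟨_⟩_
_≋⟨_⟩_ : ℕ → ℕ → ℕ → Set
i ≋⟨ p ⟩ j = Congruence._≋_ p i j

record Hole {n} (G : Graph n) (S : Subset n) : Set where
  field
    k       : ℕ
    c       : ℕ → Fin n
    c-≡⇒≋   : ∀ i j → c i ≡ c j → i ≋⟨ 3 + k ⟩ j
    ≋⇒c-≡   : ∀ i j → i ≋⟨ 3 + k ⟩ j → c i ≡ c j
    adj⇒consecutive : ∀ i j → Adj G (c i) (c j) → j ≋⟨ 3 + k ⟩ suc i ⊎ i ≋⟨ 3 + k ⟩ suc j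
    adj-suc : ∀ i → Adj G (c i) (c (suc i))
    c∈      : ∀ i → c i ∈ S
    ∈⇒c     : ∀ x → x ∈ S → ∃ λ i → c i ≡ x

module _ {n} {G : Graph n} {S : Subset n} where

  IsHole⇒Hole : IsHole G S → Hole G S
  IsHole⇒Hole (k , c , c-inj , c-image , c-adj) = record
    { k = k ; c = c′ ; c-≡⇒≋ = c-≡⇒≋ ; ≋⇒c-≡ = ≋⇒c-≡ ; adj⇒consecutive = adj⇒consecutive
    ; adj-suc = adj-suc ; c∈ = λ i → Equivalence.from (c-image (c′ i)) (_ , refl) ; ∈⇒c = ∈⇒c }
    where
      open Congruence (3 + k)
      index : ℕ → Fin (4 + k)
      index i = fromℕ< (m%n<n i (4 + k))
      c′ : ℕ → Fin n
      c′ i = c (index i)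
      toℕ-index : ∀ i → toℕ (index i) ≡ i % (4 + k)
      toℕ-index i = toℕ-fromℕ< (m%n<n i (4 + k))
      suc-% : ∀ i → suc (i % (4 + k)) % (4 + k) ≡ suc i % (4 + k)
      suc-% i = un≋ (+-congˡ-≋ 1 (%-≋ i))
      cyclic-succ : ∀ i j → CycSucc k (index i) (index j) → j ≋ suc i
      cyclic-succ i j e = mk≋ (begin
        j % (4 + k)                     ≡⟨ toℕ-index j ⟨
        toℕ (index j)                   ≡⟨ e ⟩
        suc (toℕ (index i)) % (4 + k)   ≡⟨ cong (λ z → suc z % (4 + k)) (toℕ-index i) ⟩
        suc (i % (4 + k)) % (4 + k)     ≡⟨ suc-% i ⟩
        suc i % (4 + k)                 ∎)
        where open ≡-Reasoning
      c-≡⇒≋ : ∀ i j → c′ i ≡ c′ j → i ≋ j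
      c-≡⇒≋ i j e = mk≋ (trans (sym (toℕ-index i)) (trans (cong toℕ (c-inj e)) (toℕ-index j)))
      ≋⇒c-≡ : ∀ i j → i ≋ j → c′ i ≡ c′ j
      ≋⇒c-≡ i j (mk≋ e) = cong c (toℕ-injective (trans (toℕ-index i) (trans e (sym (toℕ-index j)))))
      adj⇒consecutive : ∀ i j → Adj G (c′ i) (c′ j) → j ≋ suc i ⊎ i ≋ suc j
      adj⇒consecutive i j a = Data.Sum.map (cyclic-succ i j) (cyclic-succ j i) (Equivalence.to (c-adj (index i) (index j)) a)
      adj-suc : ∀ i → Adj G (c′ i) (c′ (suc i))
      adj-suc i = Equivalence.from (c-adj (index i) (index (suc i)))
        (inj₁ (trans (toℕ-index (suc i)) (trans (sym (suc-% i)) (cong (λ z → suc z % (4 + k)) (sym (toℕ-index i))))))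
      ∈⇒c : ∀ x → x ∈ S → ∃ λ i → c′ i ≡ x
      ∈⇒c x x∈S with Equivalence.to (c-image x) x∈S
      ... | I , cI≡x = toℕ I , trans (cong c (toℕ-injective (trans (toℕ-index (toℕ I)) (m<n⇒m%n≡m (toℕ<n I))))) cI≡x

module _ {n} {G : Graph n} {S : Subset n} (H : Hole G S) where
  open Hole H
  open Congruence (3 + k)

  rotate : ℕ → Hole G S
  rotate s = record
    { k = k
    ; c = λ i → c (s + i)
    ; c-≡⇒≋ = λ i j e → +-cancelˡ-≋ s (c-≡⇒≋ _ _ e)
    ; ≋⇒c-≡ = λ i j e → ≋⇒c-≡ _ _ (+-congˡ-≋ s e)
    ; adj⇒consecutive = λ i j a → Data.Sum.map
        (λ e → +-cancelˡ-≋ s (subst (s + j ≋_) (sym (+-suc s i)) e))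
        (λ e → +-cancelˡ-≋ s (subst (s + i ≋_) (sym (+-suc s j)) e))
        (adj⇒consecutive _ _ a)
    ; adj-suc = λ i → subst (λ z → Adj G (c (s + i)) (c z)) (sym (+-suc s i)) (adj-suc (s + i))
    ; c∈ = λ i → c∈ _
    ; ∈⇒c = λ x x∈S → let (i , ci≡x) = ∈⇒c x x∈S in neg s + i , trans (≋⇒c-≡ _ _ (+-neg-≋ s i)) ci≡x
    }

  reflect : Hole G S
  reflect = record
    { k = k
    ; c = λ i → c (neg i)
    ; c-≡⇒≋ = λ i j e → neg-cancel-≋ (c-≡⇒≋ _ _ e)
    ; ≋⇒c-≡ = λ i j e → ≋⇒c-≡ _ _ (*-congˡ-≋ (3 + k) e)
    ; adj⇒consecutive = λ i j a → Data.Sum.swap (Data.Sum.map neg-suc neg-suc (adj⇒consecutive _ _ a))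
    ; adj-suc = λ i → Adj-sym G (subst (Adj G (c (neg (suc i)))) (≋⇒c-≡ _ _ (suc-neg-suc i)) (adj-suc (neg (suc i))))
    ; c∈ = λ i → c∈ _
    ; ∈⇒c = λ x x∈S → let (i , ci≡x) = ∈⇒c x x∈S in neg i , trans (≋⇒c-≡ _ _ (neg-involutive i)) ci≡x
    }

  adj-pred : ∀ i → Adj G (c i) (c (i + (3 + k)))
  adj-pred i = Adj-sym G (subst (Adj G (c (i + (3 + k)))) (≋⇒c-≡ _ _ (suc-+p-≋ i)) (adj-suc (i + (3 + k))))

  ∈⇒c-< : ∀ x → x ∈ S → ∃ λ i → i < 4 + k × c i ≡ x
  ∈⇒c-< x x∈S = let (i , ci≡x) = ∈⇒c x x∈S in i % (4 + k) , m%n<n i (4 + k) , trans (≋⇒c-≡ _ _ (%-≋ i)) ci≡x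

  c-injective : ∀ {p q} → p ≤ 3 + k → q ≤ 3 + k → c p ≡ c q → p ≡ q
  c-injective p≤ q≤ e = ≋⇒≡ (s≤s p≤) (s≤s q≤) (c-≡⇒≋ _ _ e)

  neighbours-in-hole : ∀ i y → Adj G (c i) y → y ∈ S → y ≡ c (suc i) ⊎ y ≡ c (i + (3 + k))
  neighbours-in-hole i y ci~y y∈S with ∈⇒c y y∈S
  ... | j , refl = Data.Sum.map (≋⇒c-≡ _ _) (≋⇒c-≡ _ _ ∘ ≋suc⇒+p) (adj⇒consecutive i j ci~y)

-- Walking around T from a common vertex, each step of T is matched by a step of S,
-- because the two S-neighbours of a vertex cannot both be its T-predecessor.
hole-⊆⇒≡ : ∀ {n} {G : Graph n} {S T : Subset n} → Hole G S → Hole G T → S ⊆ T → S ≡ T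
hole-⊆⇒≡ {G = G} {S} {T} HS HT S⊆T = ⊆-antisym S⊆T T⊆S
  where
    open Hole HS using (k; c; c-≡⇒≋; c∈; ∈⇒c; adj-suc)
    open Hole HT using () renaming (k to l; c to d; ≋⇒c-≡ to ≋⇒d-≡; ∈⇒c to ∈⇒d)
    j₀ : ℕ
    j₀ = proj₁ (∈⇒d (c 0) (S⊆T (c∈ 0)))
    dj₀≡c0 : d j₀ ≡ c 0
    dj₀≡c0 = proj₂ (∈⇒d (c 0) (S⊆T (c∈ 0)))
    d∈S : ∀ m → d (j₀ + m) ∈ S
    d∈S zero = subst (_∈ S) (sym (trans (cong d (+-identityʳ j₀)) dj₀≡c0)) (c∈ 0)
    d∈S (suc m) = let (i , ci≡d) = ∈⇒c _ (d∈S m) in step m i ci≡d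
      where
        step : ∀ m i → c i ≡ d (j₀ + m) → d (j₀ + suc m) ∈ S
        step m i ci≡d with candidate (adj-suc i) (c∈ _) | candidate (adj-pred HS i) (c∈ _)
          where
            candidate : ∀ {y} → Adj G (c i) y → y ∈ S → y ≡ d (suc (j₀ + m)) ⊎ y ≡ d (j₀ + m + (3 + l))
            candidate {y} ci~y y∈S = neighbours-in-hole HT (j₀ + m) y (subst (λ z → Adj G z y) ci≡d ci~y) (S⊆T y∈S)
        ... | inj₁ e | _       = subst (_∈ S) (trans e (cong d (sym (+-suc j₀ m)))) (c∈ _)
        ... | inj₂ _ | inj₁ e  = subst (_∈ S) (trans e (cong d (sym (+-suc j₀ m)))) (c∈ _)
        ... | inj₂ e₁ | inj₂ e₂ =
          ⊥-elim (Congruence.suc≉pred (3 + k) (s≤s (s≤s z≤n)) i (c-≡⇒≋ _ _ (trans e₁ (sym e₂))))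
    T⊆S : T ⊆ S
    T⊆S {x} x∈T with ∈⇒d x x∈T
    ... | j , refl = subst (_∈ S) (≋⇒d-≡ _ _ (Congruence.+-neg-≋ (3 + l) j₀ j)) (d∈S (Congruence.neg (3 + l) j₀ + j))

module _ {n} {G : Graph n} {T : Subset n} (H : Hole G T) where
  open Hole H
  open Congruence (3 + k)

  hole-from-edge : ∀ {u v} → Adj G u v → u ∈ T → v ∈ T → Σ (Hole G T) λ H′ → Hole.c H′ 0 ≡ u × Hole.c H′ 1 ≡ v
  hole-from-edge {u} {v} u~v u∈T v∈T with ∈⇒c u u∈T
  ... | j , refl with neighbours-in-hole H j v u~v v∈T
  ...   | inj₁ refl = rotate H j , cong c (+-identityʳ j) , cong c (trans (+-suc j 0) (cong suc (+-identityʳ j)))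
  ...   | inj₂ refl = rotate (reflect H) (neg j) , ≋⇒c-≡ _ _ start , ≋⇒c-≡ _ _ next
    where
      start : neg (neg j + 0) ≋ j
      start = ≋-trans (≋-reflexive (cong neg (+-identityʳ (neg j)))) (neg-involutive j)
      next : neg (neg j + 1) ≋ j + (3 + k)
      next = begin
        neg (neg j + 1)         ≡⟨ cong neg (+-comm (neg j) 1) ⟩
        neg (suc (neg j))       ≡⟨ *-suc (3 + k) (neg j) ⟩
        (3 + k) + neg (neg j)   ≈⟨ +-congˡ-≋ (3 + k) (neg-involutive j) ⟩
        (3 + k) + j             ≡⟨ +-comm (3 + k) j ⟩
        j + (3 + k)             ∎
        where open ≋-Reasoning

agree-along : ∀ {n} {G : Graph n} {S T : Subset n} (HS : Hole G S) (HT : Hole G T) →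
              Hole.c HT 0 ≡ Hole.c HS 0 → Hole.c HT 1 ≡ Hole.c HS 1 →
              ∀ r → (∀ q → q ≤ r → Hole.c HS q ∈ T) → ∀ q → q ≤ r → Hole.c HT q ≡ Hole.c HS q
agree-along {G = G} HS HT d0≡c0 d1≡c1 r c∈T = agree
  where
    open Hole HS using (k; c; c-≡⇒≋; adj-suc)
    open Hole HT using () renaming (k to l; c to d; ≋⇒c-≡ to ≋⇒d-≡)
    agree-pair : ∀ q → suc q ≤ r → d q ≡ c q × d (suc q) ≡ c (suc q)
    agree-pair zero _ = d0≡c0 , d1≡c1
    agree-pair (suc q) 2+q≤r with agree-pair q (≤-trans (n≤1+n _) 2+q≤r)
    ... | dq≡cq , d1+q≡c1+q
      with neighbours-in-hole HT (suc q) (c (2 + q)) (subst (λ z → Adj G z (c (2 + q))) (sym d1+q≡c1+q) (adj-suc (suc q)))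
                              (c∈T (2 + q) 2+q≤r)
    ... | inj₁ e = d1+q≡c1+q , sym e
    ... | inj₂ e = ⊥-elim (Congruence.suc-suc≉ (3 + k) (s≤s (s≤s z≤n)) q (c-≡⇒≋ _ _ (trans e (trans (≋⇒d-≡ _ _ back) dq≡cq))))
      where
        back : suc q + (3 + l) ≋⟨ 3 + l ⟩ q
        back = Congruence.suc-+p-≋ (3 + l) q
    agree : ∀ q → q ≤ r → d q ≡ c q
    agree zero _ = d0≡c0
    agree (suc q) 1+q≤r = proj₂ (agree-pair q 1+q≤r)

module _ {n} {G : Graph n} {S : Subset n} (H : Hole G S) (T : Subset n) where
  open Hole H
  open Congruence (3 + k)

  EdgeWithin : ℕ → Set
  EdgeWithin i = c i ∈ T × c (suc i) ∈ T

  edgeWithin? : ∀ i → Dec (EdgeWithin i)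
  edgeWithin? i = (c i ∈? T) ×-dec (c (suc i) ∈? T)

  edgeWithin-≋ : ∀ {i j} → i ≋ j → EdgeWithin i → EdgeWithin j
  edgeWithin-≋ i≋j (ci∈T , c1+i∈T) = subst (_∈ T) (≋⇒c-≡ _ _ i≋j) ci∈T , subst (_∈ T) (≋⇒c-≡ _ _ (+-congˡ-≋ 1 i≋j)) c1+i∈T

  vertex∉ : Hole G T → S ≢ T → ∃ λ x → c x ∉ T
  vertex∉ HT S≢T with find-least (λ x → c x ∉ T) (λ x → ¬? (c x ∈? T)) (4 + k)
  ... | inj₁ (x , _ , cx∉T , _) = x , cx∉T
  ... | inj₂ none = ⊥-elim (S≢T (hole-⊆⇒≡ H HT S⊆T))
    where
      S⊆T : S ⊆ T
      S⊆T {x} x∈S with ∈⇒c-< H x x∈S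
      ... | i , i<L , refl = decidable-stable (_ ∈? T) (none i i<L)

rotate-edgeWithin : ∀ {n} {G : Graph n} {S : Subset n} (H : Hole G S) (T : Subset n) s i →
                    EdgeWithin H T (s + i) ⇔ EdgeWithin (rotate H s) T i
rotate-edgeWithin H T s i = mk⇔ (λ (p , q) → p , subst (λ z → Hole.c H z ∈ T) (sym (+-suc s i)) q)
                                (λ (p , q) → p , subst (λ z → Hole.c H z ∈ T) (+-suc s i) q)

common-edge⇒edgeWithin : ∀ {n} {G : Graph n} {S T : Subset n} (H : Hole G S) →
                         ∀ {u v} → CommonEdge G S T u v → ∃ (EdgeWithin H T)
common-edge⇒edgeWithin {T = T} H {u} {v} ((u~v , u∈S , v∈S) , (_ , u∈T , v∈T)) with Hole.∈⇒c H u u∈S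
... | i , refl with neighbours-in-hole H i v u~v v∈S
...   | inj₁ refl = i , u∈T , v∈T
...   | inj₂ refl = _ , v∈T , subst (_∈ T) (Hole.≋⇒c-≡ H _ _ (Congruence.≋-sym (3 + Hole.k H) (Congruence.suc-+p-≋ (3 + Hole.k H) i))) u∈T

record MaximalRun {n} {G : Graph n} {S : Subset n} (H : Hole G S) (T : Subset n) : Set where
  field
    r        : ℕ
    1≤r      : 1 ≤ r
    c∈T      : ∀ q → q ≤ r → Hole.c H q ∈ T
    c-next∉T : Hole.c H (suc r) ∉ T
    c-last∉T : Hole.c H (3 + Hole.k H) ∉ T

-- Walking up from a non-common edge to a periodic copy of a common one finds a common edge
-- preceded by a non-common one; starting there, the common edges stop before wrapping around.
maximal-run : ∀ {n} {G : Graph n} {S T : Subset n} (H : Hole G S) → Hole G T → S ≢ T →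
              ∃ (EdgeWithin H T) → Σ (Hole G S) λ H′ → MaximalRun H′ T
maximal-run {T = T} H HT S≢T (p , edge-p) = H′ , run
  where
    open Hole H using (k)
    open Congruence (3 + k)
    H₀ = rotate H p
    edge₀ : EdgeWithin H₀ T 0
    edge₀ = Equivalence.to (rotate-edgeWithin H T p 0) (edgeWithin-≋ H T (≋-reflexive (sym (+-identityʳ p))) edge-p)
    edge₀-periodic : ∀ q → EdgeWithin H₀ T (q * (4 + k))
    edge₀-periodic q = edgeWithin-≋ H₀ T (≋-sym (*L-≋0 q)) edge₀
    outside = vertex∉ H₀ T HT S≢T
    x = proj₁ outside
    boundary : ∃ λ s → ¬ EdgeWithin H₀ T s × EdgeWithin H₀ T (suc s)
    boundary = rise (EdgeWithin H₀ T) (edgeWithin? H₀ T) (m≤m*n (suc x) (4 + k))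
                    (proj₂ outside ∘ proj₁) (edge₀-periodic (suc x))
    s = proj₁ boundary
    H′ = rotate H₀ (suc s)
    edge′0 : EdgeWithin H′ T 0
    edge′0 = Equivalence.to (rotate-edgeWithin H₀ T (suc s) 0)
               (edgeWithin-≋ H₀ T (≋-reflexive (sym (+-identityʳ (suc s)))) (proj₂ (proj₂ boundary)))
    ¬edge′-last : ¬ EdgeWithin H′ T (3 + k)
    ¬edge′-last e = proj₁ (proj₂ boundary) (edgeWithin-≋ H₀ T (suc-+p-≋ s) (Equivalence.from (rotate-edgeWithin H₀ T (suc s) (3 + k)) e))
    fall = first-failure (EdgeWithin H′ T) (edgeWithin? H′ T) edge′0 ¬edge′-last
    r = proj₁ fall
    run : MaximalRun H′ T
    run = record
      { r = suc r
      ; 1≤r = s≤s z≤n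
      ; c∈T = λ { zero _ → proj₁ edge′0 ; (suc q) q<r → proj₂ (proj₁ (proj₂ fall) q (≤-pred q<r)) }
      ; c-next∉T = λ c′r+2∈T → proj₂ (proj₂ fall) (proj₂ (proj₁ (proj₂ fall) r ≤-refl) , c′r+2∈T)
      ; c-last∉T = λ c′last∈T → ¬edge′-last (c′last∈T , subst (_∈ T) (Hole.≋⇒c-≡ H′ _ _ (≋-sym (+-L-≋ 0))) (proj₁ edge′0))
      }

-- In the field names, c and d are the vertex sequences of HS and HT.
record Overlap {n} {G : Graph n} {S T : Subset n} (HS : Hole G S) (HT : Hole G T) : Set where
  field
    r         : ℕ
    1≤r       : 1 ≤ r
    agree     : ∀ q → q ≤ r → Hole.c HT q ≡ Hole.c HS q
    c-next∉T  : Hole.c HS (suc r) ∉ T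
    c-last∉T  : Hole.c HS (3 + Hole.k HS) ∉ T
    d-next∉S  : Hole.c HT (suc r) ∉ S
    d-last∉S  : Hole.c HT (3 + Hole.k HT) ∉ S

align : ∀ {n} {G : Graph n} {S T : Subset n} (HS : Hole G S) → MaximalRun HS T → Hole G T →
        Σ (Hole G T) λ HT → Overlap HS HT
align {G = G} {S} {T} HS run HT₀ = HT , record
  { r = r ; 1≤r = 1≤r ; agree = agree ; c-next∉T = c-next∉T ; c-last∉T = c-last∉T
  ; d-next∉S = d-next∉S ; d-last∉S = d-last∉S }
  where
    open MaximalRun run
    open Hole HS using (k; c; c∈; adj-suc)
    start = hole-from-edge HT₀ (adj-suc 0) (c∈T 0 z≤n) (c∈T 1 1≤r)
    HT = proj₁ start
    open Hole HT using () renaming (k to l; c to d; c∈ to d∈; c-≡⇒≋ to d-≡⇒≋)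
    agree : ∀ q → q ≤ r → d q ≡ c q
    agree = agree-along HS HT (proj₁ (proj₂ start)) (proj₂ (proj₂ start)) r c∈T
    d-next∉S : d (suc r) ∉ S
    d-next∉S d1+r∈S with neighbours-in-hole HS r (d (suc r)) (subst (λ z → Adj G z (d (suc r))) (agree r ≤-refl) (Hole.adj-suc HT r)) d1+r∈S
    ... | inj₁ e = c-next∉T (subst (_∈ T) e (d∈ (suc r)))
    ... | inj₂ e = Congruence.suc-suc≉ (3 + l) (s≤s (s≤s z≤n)) (r ∸ 1) (d-≡⇒≋ _ _ (begin
      d (2 + (r ∸ 1))        ≡⟨ cong (d ∘ suc) r≡ ⟩
      d (suc r)              ≡⟨ e ⟩
      c (r + (3 + k))        ≡⟨ Hole.≋⇒c-≡ HS _ _ (≋S.≋-trans (≋S.≋-reflexive (cong (_+ (3 + k)) (sym r≡))) (≋S.suc-+p-≋ (r ∸ 1))) ⟩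
      c (r ∸ 1)              ≡⟨ agree (r ∸ 1) (m∸n≤m r 1) ⟨
      d (r ∸ 1)              ∎))
      where
        open ≡-Reasoning
        module ≋S = Congruence (3 + k)
        r≡ : suc (r ∸ 1) ≡ r
        r≡ = m+[n∸m]≡n 1≤r
    d-last∉S : d (3 + l) ∉ S
    d-last∉S d-last∈S with neighbours-in-hole HS 0 (d (3 + l)) (subst (λ z → Adj G z (d (3 + l))) (agree 0 z≤n) (adj-pred HT 0)) d-last∈S
    ... | inj₁ e = 3+l≢1 (Congruence.≋⇒≡ (3 + l) ≤-refl (s≤s (s≤s z≤n)) (d-≡⇒≋ _ _ (trans e (sym (agree 1 1≤r)))))
      where
        3+l≢1 : 3 + l ≢ 1
        3+l≢1 ()
    ... | inj₂ e = c-last∉T (subst (_∈ T) e (d∈ _))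

module _ {n} {G : Graph n} {S T : Subset n} {HS : Hole G S} {HT : Hole G T} (O : Overlap HS HT) where
  open Hole HS using (k; c; c∈)
  open Hole HT using () renaming (k to l; c to d; c∈ to d∈)
  open Overlap O

  r≤k+2 : r ≤ 2 + k
  r≤k+2 with r ≤? 2 + k
  ... | yes r≤ = r≤
  ... | no r≰ = ⊥-elim (c-last∉T (subst (_∈ T) (agree (3 + k) (≰⇒> r≰)) (d∈ _)))

  r≤l+2 : r ≤ 2 + l
  r≤l+2 with r ≤? 2 + l
  ... | yes r≤ = r≤
  ... | no r≰ = ⊥-elim (d-last∉S (subst (_∈ S) (sym (agree (3 + l) (≰⇒> r≰))) (c∈ _)))

  record Crossing : Set where
    field
      i j     : ℕ
      2+r≤i   : 2 + r ≤ i
      i≤k+2   : i ≤ 2 + k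
      2+r≤j   : 2 + r ≤ j
      j≤l+2   : j ≤ 2 + l
      ci≡dj   : c i ≡ d j

-- The detour goes from c r along S to the crossing and on along T to d (4 + l) = c 0.
module ThirdHole {n} {G : Graph n} {S T : Subset n} {HS : Hole G S} {HT : Hole G T}
                 (O : Overlap HS HT) (X : Crossing O) where
  open Hole HS using (k; c; c∈) renaming (adj⇒consecutive to c-adj; adj-suc to c-adj-suc)
  open Hole HT using () renaming (k to l; c to d; c∈ to d∈; ≋⇒c-≡ to ≋⇒d-≡; adj⇒consecutive to d-adj; adj-suc to d-adj-suc)
  open Overlap O
  open Crossing X
  module ≋S = Congruence (3 + k)
  module ≋T = Congruence (3 + l)

  a b : Fin n
  a = c 0
  b = c r

  Outer : Fin n → Set
  Outer z = (∃ λ q → suc r ≤ q × q ≤ 2 + k × z ≡ c q) ⊎ (∃ λ q → 2 + r ≤ q × q ≤ 3 + l × z ≡ d q)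

  ≤k+3 : ∀ {q} → q ≤ 2 + k → q ≤ 3 + k
  ≤k+3 = m≤n⇒m≤1+n
  ≤l+3 : ∀ {q} → q ≤ 2 + l → q ≤ 3 + l
  ≤l+3 = m≤n⇒m≤1+n

  c-inj : ∀ {p q} → p ≤ 3 + k → q ≤ 3 + k → c p ≡ c q → p ≡ q
  c-inj = c-injective HS
  d-inj : ∀ {p q} → p ≤ 3 + l → q ≤ 3 + l → d p ≡ d q → p ≡ q
  d-inj = c-injective HT

  outer≢inner : ∀ {z} → Outer z → ∀ p → p ≤ r → z ≢ c p
  outer≢inner (inj₁ (q , r<q , q≤ , refl)) p p≤r e =
    <⇒≢ (≤-<-trans p≤r r<q) (sym (c-inj (≤k+3 q≤) (≤-trans p≤r (≤k+3 (r≤k+2 O))) e))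
  outer≢inner (inj₂ (q , r+1<q , q≤ , refl)) p p≤r e =
    <⇒≢ (≤-<-trans p≤r (≤-trans (n≤1+n _) r+1<q)) (sym (d-inj q≤ (≤-trans p≤r (≤l+3 (r≤l+2 O))) (trans e (sym (agree p p≤r)))))

  outer≁inner : ∀ {z} → Outer z → ∀ p → 0 < p → p < r → ¬ Adj G z (c p)
  outer≁inner (inj₁ (q , r<q , q≤ , refl)) p 0<p p<r cq~cp with c-adj q p cq~cp
  ... | inj₁ p≋1+q = <⇒≱ (<-trans p<r r<q)
                       (≤-trans (n≤1+n q) (≤-reflexive (sym (≋S.≋⇒≡ (<-trans p<r (s≤s (≤k+3 (r≤k+2 O)))) (s≤s (s≤s q≤)) p≋1+q))))
  ... | inj₂ q≋1+p = <⇒≱ r<q (≤-trans (≤-reflexive (≋S.≋⇒≡ (s≤s (≤k+3 q≤)) (s≤s (≤-trans p<r (≤k+3 (r≤k+2 O)))) q≋1+p)) p<r)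
  outer≁inner (inj₂ (q , r+1<q , q≤ , refl)) p 0<p p<r dq~cp with d-adj q p (subst (Adj G (d q)) (sym (agree p (<⇒≤ p<r))) dq~cp)
  ... | inj₂ q≋1+p = <⇒≱ r+1<q (≤-trans (≤-reflexive (≋T.≋⇒≡ (s≤s q≤) (s≤s (≤-trans p<r (≤l+3 (r≤l+2 O)))) q≋1+p)) (≤-trans p<r (n≤1+n r)))
  ... | inj₁ p≋1+q with ≋T.≋⇒≡⊎wrap (<-trans p<r (s≤s (≤l+3 (r≤l+2 O)))) (s≤s q≤) p≋1+q
  ...   | inj₁ p≡1+q = <⇒≱ (<-trans p<r (≤-trans (n≤1+n _) r+1<q)) (≤-trans (n≤1+n q) (≤-reflexive (sym p≡1+q)))
  ...   | inj₂ (p≡0 , _) = <⇒≢ 0<p (sym p≡0)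

  outer≢c-last : ∀ {z} → Outer z → z ≢ c (3 + k)
  outer≢c-last (inj₁ (q , _ , q≤ , refl)) e = 1+n≰n (≤-trans (≤-reflexive (cong suc (sym (c-inj (≤k+3 q≤) ≤-refl e)))) (s≤s q≤))
  outer≢c-last (inj₂ (q , _ , _ , refl)) e = c-last∉T (subst (_∈ T) e (d∈ q))

  outer≢d-next : ∀ {z} → Outer z → z ≢ d (suc r)
  outer≢d-next (inj₁ (q , _ , _ , refl)) e = d-next∉S (subst (_∈ S) e (c∈ q))
  outer≢d-next (inj₂ (q , r+1<q , q≤ , refl)) e = 1+n≰n (≤-trans r+1<q (≤-reflexive (d-inj q≤ (s≤s (r≤l+2 O)) e)))

  outer≁both-ends : ∀ {z} → Outer z → Adj G z a → Adj G z b → ⊥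
  outer≁both-ends (inj₁ (q , r<q , q≤ , refl)) cq~a _ with c-adj q 0 cq~a
  ... | inj₁ 0≋1+q = 0≢1+n (≋S.≋⇒≡ (s≤s z≤n) (s≤s (s≤s q≤)) 0≋1+q)
  ... | inj₂ q≋1 = 1+n≰n (≤-trans (s≤s 1≤r) (≤-trans r<q (≤-reflexive (≋S.≋⇒≡ (s≤s (≤k+3 q≤)) (s≤s (s≤s z≤n)) q≋1))))
  outer≁both-ends (inj₂ (q , r+1<q , q≤ , refl)) _ dq~b with d-adj q r (subst (Adj G (d q)) (sym (agree r ≤-refl)) dq~b)
  ... | inj₂ q≋1+r = 1+n≰n (≤-trans r+1<q (≤-reflexive (≋T.≋⇒≡ (s≤s q≤) (s≤s (s≤s (r≤l+2 O))) q≋1+r)))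
  ... | inj₁ r≋1+q with ≋T.≋⇒≡⊎wrap (s≤s (≤l+3 (r≤l+2 O))) (s≤s q≤) r≋1+q
  ...   | inj₁ r≡1+q = <⇒≱ (≤-trans (n≤1+n _) r+1<q) (≤-trans (n≤1+n q) (≤-reflexive (sym r≡1+q)))
  ...   | inj₂ (r≡0 , _) = <⇒≢ 1≤r (sym r≡0)

  a≢b : a ≢ b
  a≢b e = <⇒≢ 1≤r (c-inj z≤n (≤k+3 (r≤k+2 O)) e)

  open Walks G a b a≢b (λ z → z ≡ a ⊎ z ≡ b ⊎ Outer z)

  α β : ℕ
  α = i ∸ r
  β = (4 + l) ∸ j

  r+α≡i : r + α ≡ i
  r+α≡i = m+[n∸m]≡n (≤-trans (n≤1+n r) (≤-trans (n≤1+n _) 2+r≤i))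
  j+β≡L : j + β ≡ 4 + l
  j+β≡L = m+[n∸m]≡n (≤-trans j≤l+2 (≤-trans (n≤1+n _) (n≤1+n _)))
  2≤α : 2 ≤ α
  2≤α = +-cancelˡ-≤ r 2 α (subst (r + 2 ≤_) (sym r+α≡i) (subst (_≤ i) (+-comm 2 r) 2+r≤i))
  2≤β : 2 ≤ β
  2≤β = +-cancelˡ-≤ j 2 β (subst (j + 2 ≤_) (trans (+-comm (2 + l) 2) (sym j+β≡L)) (+-monoˡ-≤ 2 j≤l+2))

  detour-vertex : ℕ → Fin n
  detour-vertex t with t ≤? α
  ... | yes _ = c (r + t)
  ... | no  _ = d (j + (t ∸ α))

  α+[t∸α] : ∀ {t} → ¬ t ≤ α → α + (t ∸ α) ≡ t
  α+[t∸α] t≰α = m+[n∸m]≡n (<⇒≤ (≰⇒> t≰α))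

  detour-outer : ∀ t → 0 < t → t < α + β → Outer (detour-vertex t)
  detour-outer t 0<t t<len with t ≤? α
  ... | yes t≤α = inj₁ (r + t , subst (_≤ r + t) (+-comm r 1) (+-monoʳ-≤ r 0<t) ,
                        ≤-trans (subst (r + t ≤_) r+α≡i (+-monoʳ-≤ r t≤α)) i≤k+2 , refl)
  ... | no t≰α = inj₂ (j + (t ∸ α) , ≤-trans 2+r≤j (m≤m+n j _) ,
                       ≤-pred (subst (j + (t ∸ α) <_) j+β≡L (+-monoʳ-< j t∸α<β)) , refl)
    where
      t∸α<β : t ∸ α < β
      t∸α<β = +-cancelˡ-< α (t ∸ α) β (subst (_< α + β) (sym (α+[t∸α] t≰α)) t<len)

  detour-start : detour-vertex 0 ≡ b
  detour-start with 0 ≤? α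
  ... | yes _ = cong c (+-identityʳ r)
  ... | no 0≰α = ⊥-elim (0≰α z≤n)

  detour-end : detour-vertex (α + β) ≡ a
  detour-end with α + β ≤? α
  ... | yes len≤α = ⊥-elim (1+n≰n (≤-trans (subst (suc α ≤_) (+-comm β α) (+-monoˡ-≤ α (≤-trans (s≤s z≤n) 2≤β))) len≤α))
  ... | no _ = begin
    d (j + (α + β ∸ α)) ≡⟨ cong (λ z → d (j + z)) (m+n∸m≡n α β) ⟩
    d (j + β)           ≡⟨ cong d j+β≡L ⟩
    d (4 + l)           ≡⟨ ≋⇒d-≡ _ _ (≋T.+-L-≋ 0) ⟩
    d 0                 ≡⟨ agree 0 z≤n ⟩
    c 0                 ∎
    where open ≡-Reasoning

  detour-adj : ∀ t → t < α + β → Adj G (detour-vertex t) (detour-vertex (suc t))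
  detour-adj t _ with t ≤? α | suc t ≤? α
  ... | yes _   | yes _  = subst (λ z → Adj G (c (r + t)) (c z)) (sym (+-suc r t)) (c-adj-suc (r + t))
  ... | no t≰α  | yes t<α = ⊥-elim (t≰α (≤-trans (n≤1+n t) t<α))
  ... | no t≰α  | no _   = subst (λ z → Adj G (d (j + (t ∸ α))) (d z))
                             (trans (sym (+-suc j _)) (cong (j +_) (sym (+-∸-assoc 1 (<⇒≤ (≰⇒> t≰α))))))
                             (d-adj-suc (j + (t ∸ α)))
  ... | yes t≤α | no t≮α with ≤-antisym t≤α (≤-pred (≰⇒> t≮α))
  ...   | refl = subst₂ (λ x y → Adj G x (d y)) (sym (trans (cong c r+α≡i) ci≡dj))
                   (trans (+-comm 1 j) (cong (j +_) (sym (m+n∸n≡m 1 t))))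
                   (d-adj-suc j)

  detour : Walk
  detour = record
    { len = α + β ; W = detour-vertex ; 2≤len = ≤-trans 2≤α (m≤m+n α β)
    ; W0≡b = detour-start ; Wlen≡a = detour-end ; W-adj = detour-adj
    ; W∈V = W∈V ; interior≢ends = λ t 0<t t<len → let o = detour-outer t 0<t t<len in
                                   outer≢inner o 0 z≤n , outer≢inner o r ≤-refl }
    where
      W∈V : ∀ t → t ≤ α + β → _
      W∈V zero _ = inj₂ (inj₁ detour-start)
      W∈V (suc t) t<len with m≤n⇒m<n∨m≡n t<len
      ... | inj₁ 1+t<len = inj₂ (inj₂ (detour-outer (suc t) (s≤s z≤n) 1+t<len))
      ... | inj₂ 1+t≡len = inj₁ (trans (cong detour-vertex 1+t≡len) detour-end)

  abstract
    path : Σ Walk Induced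
    path = induced-subwalk detour

  open Walk (proj₁ path) renaming (len to m; W to P; W0≡b to P0≡b; Wlen≡a to Pm≡a; W-adj to P-adj)
  open Induced (proj₂ path) renaming (W-injective to P-injective; chordless to P-chordless)

  P-outer : ∀ s → 0 < s → s < m → Outer (P s)
  P-outer s 0<s s<m with W∈V s (<⇒≤ s<m)
  ... | inj₁ e        = ⊥-elim (proj₁ (interior≢ends s 0<s s<m) e)
  ... | inj₂ (inj₁ e) = ⊥-elim (proj₂ (interior≢ends s 0<s s<m) e)
  ... | inj₂ (inj₂ o) = o

  P-start-or-outer : ∀ s → s < m → s ≡ 0 ⊎ Outer (P s)
  P-start-or-outer zero _ = inj₁ refl
  P-start-or-outer (suc s) s<m = inj₂ (P-outer (suc s) (s≤s z≤n) s<m)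

  N : ℕ
  N = r + m

  h : ℕ → Fin n
  h t with t <? r
  ... | yes _ = c t
  ... | no  _ = P (t ∸ r)

  r+[t∸r] : ∀ {t} → ¬ t < r → r + (t ∸ r) ≡ t
  r+[t∸r] t≮r = m+[n∸m]≡n (≮⇒≥ t≮r)

  t∸r<m : ∀ {t} → ¬ t < r → t < N → t ∸ r < m
  t∸r<m t≮r t<N = +-cancelˡ-< r _ _ (subst (_< N) (sym (r+[t∸r] t≮r)) t<N)

  <r⇒≤k+3 : ∀ {t} → t < r → t ≤ 3 + k
  <r⇒≤k+3 t<r = ≤-trans (<⇒≤ t<r) (≤k+3 (r≤k+2 O))

  h-inner-or-outer : ∀ t → t < N → (∃ λ p → p ≤ r × h t ≡ c p) ⊎ Outer (h t)
  h-inner-or-outer t t<N with t <? r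
  ... | yes t<r = inj₁ (t , <⇒≤ t<r , refl)
  ... | no t≮r with P-start-or-outer (t ∸ r) (t∸r<m t≮r t<N)
  ...   | inj₁ e = inj₁ (r , ≤-refl , trans (cong P e) P0≡b)
  ...   | inj₂ o = inj₂ o

  inner≢path : ∀ {t t'} → t < r → ¬ t' < r → t' < N → c t ≢ P (t' ∸ r)
  inner≢path {t} {t'} t<r t'≮r t'<N e with P-start-or-outer (t' ∸ r) (t∸r<m t'≮r t'<N)
  ... | inj₁ s≡0 = <⇒≢ t<r (c-inj (<r⇒≤k+3 t<r) (≤k+3 (r≤k+2 O)) (trans e (trans (cong P s≡0) P0≡b)))
  ... | inj₂ o   = outer≢inner o t (<⇒≤ t<r) (sym e)

  h-injective : ∀ t t' → t < N → t' < N → h t ≡ h t' → t ≡ t'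
  h-injective t t' t<N t'<N e with t <? r | t' <? r
  ... | yes t<r | yes t'<r = c-inj (<r⇒≤k+3 t<r) (<r⇒≤k+3 t'<r) e
  ... | yes t<r | no t'≮r = ⊥-elim (inner≢path t<r t'≮r t'<N e)
  ... | no t≮r | yes t'<r = ⊥-elim (inner≢path t'<r t≮r t<N (sym e))
  ... | no t≮r | no t'≮r =
    trans (sym (r+[t∸r] t≮r)) (trans (cong (r +_) (P-injective _ _ (<⇒≤ (t∸r<m t≮r t<N)) (<⇒≤ (t∸r<m t'≮r t'<N)) e)) (r+[t∸r] t'≮r))

  inner~inner : ∀ {t t'} → t < t' → t' < r → Adj G (c t) (c t') → t' ≡ suc t
  inner~inner {t} {t'} t<t' t'<r ct~ct' with c-adj t t' ct~ct'
  ... | inj₁ t'≋1+t = ≋S.≋⇒≡ (s≤s (<r⇒≤k+3 t'<r)) (s≤s (<r⇒≤k+3 (≤-<-trans t<t' t'<r))) t'≋1+t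
  ... | inj₂ t≋1+t' = ⊥-elim (<⇒≱ t<t' (≤-trans (n≤1+n t')
                        (≤-reflexive (sym (≋S.≋⇒≡ (s≤s (<r⇒≤k+3 (<-trans t<t' t'<r))) (s≤s (≤-trans t'<r (≤k+3 (r≤k+2 O)))) t≋1+t')))))

  inner~path : ∀ {t s} → t < r → s < m → Adj G (c t) (P s) → (s ≡ 0 × r ≡ suc t) ⊎ (t ≡ 0 × suc s ≡ m)
  inner~path {t} {s} t<r s<m ct~Ps with P-start-or-outer s s<m
  ... | inj₁ refl with c-adj t r (subst (Adj G (c t)) P0≡b ct~Ps)
  ...   | inj₁ r≋1+t = inj₁ (refl , ≋S.≋⇒≡ (s≤s (≤k+3 (r≤k+2 O))) (s≤s (≤-trans t<r (≤k+3 (r≤k+2 O)))) r≋1+t)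
  ...   | inj₂ t≋1+r = ⊥-elim (<⇒≱ t<r (≤-trans (n≤1+n r)
                          (≤-reflexive (sym (≋S.≋⇒≡ (s≤s (<r⇒≤k+3 t<r)) (s≤s (s≤s (r≤k+2 O))) t≋1+r)))))
  inner~path {t} {s} t<r s<m ct~Ps | inj₂ o with t ≟ 0
  ... | no t≢0 = ⊥-elim (outer≁inner o t (n≢0⇒n>0 t≢0) t<r (Adj-sym G ct~Ps))
  ... | yes refl with P-chordless s m ≤-refl s<m (subst (Adj G (P s)) (sym Pm≡a) (Adj-sym G ct~Ps))
  ...   | inj₁ m≡1+s = inj₂ (refl , sym m≡1+s)
  ...   | inj₂ (s≡0 , _) = ⊥-elim (outer≢inner o r ≤-refl (trans (cong P s≡0) P0≡b))

  h-chordless : ∀ t t' → t < t' → t' < N → Adj G (h t) (h t') → t' ≡ suc t ⊎ (t ≡ 0 × suc t' ≡ N)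
  h-chordless t t' t<t' t'<N ht~ht' with t <? r | t' <? r
  ... | yes t<r | yes t'<r = inj₁ (inner~inner t<t' t'<r ht~ht')
  ... | no t≮r  | yes t'<r = ⊥-elim (t≮r (<-trans t<t' t'<r))
  ... | yes t<r | no t'≮r with inner~path t<r (t∸r<m t'≮r t'<N) ht~ht'
  ...   | inj₁ (s≡0 , r≡1+t) = inj₁ (trans (sym (r+[t∸r] t'≮r)) (trans (cong (r +_) s≡0) (trans (+-identityʳ r) r≡1+t)))
  ...   | inj₂ (t≡0 , 1+s≡m) = inj₂ (t≡0 , trans (cong suc (sym (r+[t∸r] t'≮r))) (trans (sym (+-suc r _)) (cong (r +_) 1+s≡m)))
  h-chordless t t' t<t' t'<N ht~ht' | no t≮r | no t'≮r
    with P-chordless (t ∸ r) (t' ∸ r) (<⇒≤ (t∸r<m t'≮r t'<N))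
                     (+-cancelˡ-< r _ _ (subst₂ _<_ (sym (r+[t∸r] t≮r)) (sym (r+[t∸r] t'≮r)) t<t')) ht~ht'
  ... | inj₁ e = inj₁ (trans (sym (r+[t∸r] t'≮r)) (trans (cong (r +_) e) (trans (+-suc r _) (cong suc (r+[t∸r] t≮r)))))
  ... | inj₂ (_ , e) = ⊥-elim (<-irrefl e (t∸r<m t'≮r t'<N))

  h-adj-suc : ∀ t → suc t < N → Adj G (h t) (h (suc t))
  h-adj-suc t 1+t<N with t <? r | suc t <? r
  ... | yes _   | yes _    = c-adj-suc t
  ... | no t≮r  | yes 1+t<r = ⊥-elim (t≮r (<-trans (n<1+n t) 1+t<r))
  ... | no t≮r  | no _     = subst (λ z → Adj G (P (t ∸ r)) (P z)) (sym (+-∸-assoc 1 (≮⇒≥ t≮r)))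
                               (P-adj (t ∸ r) (t∸r<m t≮r (<-trans (n<1+n t) 1+t<N)))
  ... | yes t<r | no 1+t≮r with ≤-antisym t<r (≮⇒≥ 1+t≮r)
  ...   | refl = subst (Adj G (c t)) (sym (trans (cong P (n∸n≡0 (suc t))) P0≡b)) (c-adj-suc t)

  h-adj-wrap : ∀ t → suc t ≡ N → Adj G (h t) (h 0)
  h-adj-wrap t 1+t≡N with 0 <? r | t <? r
  ... | no 0≮r  | _       = ⊥-elim (0≮r 1≤r)
  ... | yes _   | yes t<r = ⊥-elim (<⇒≱ (m<m+n r (≤-trans (s≤s z≤n) 2≤len)) (subst (_≤ r) 1+t≡N t<r))
  ... | yes _   | no t≮r  = subst (Adj G (P (t ∸ r))) (trans (cong P 1+s≡m) Pm≡a)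
                              (P-adj (t ∸ r) (t∸r<m t≮r (subst (t <_) 1+t≡N (n<1+n t))))
    where
      1+s≡m : suc (t ∸ r) ≡ m
      1+s≡m = +-cancelˡ-≡ r _ _ (trans (+-suc r _) (trans (cong suc (r+[t∸r] t≮r)) 1+t≡N))

  -- A path of length 2 cannot close up with r = 1, as its middle vertex would see both a and b.
  4≤N : 4 ≤ N
  4≤N with 3 ≤? m | 2 ≤? r
  ... | yes 3≤m | _       = +-mono-≤ 1≤r 3≤m
  ... | no 3≰m  | yes 2≤r = +-mono-≤ 2≤r 2≤len
  ... | no 3≰m  | no _    = ⊥-elim (outer≁both-ends (P-outer 1 (s≤s z≤n) 1<m) P1~a P1~b)
    where
      m≡2 : m ≡ 2
      m≡2 = sym (≤-antisym 2≤len (≤-pred (≰⇒> 3≰m)))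
      1<m : 1 < m
      1<m = subst (1 <_) (sym m≡2) (s≤s (s≤s z≤n))
      P1~b : Adj G (P 1) b
      P1~b = subst (Adj G (P 1)) P0≡b (Adj-sym G (P-adj 0 (≤-trans (s≤s z≤n) 2≤len)))
      P1~a : Adj G (P 1) a
      P1~a = subst (Adj G (P 1)) (trans (cong P (sym m≡2)) Pm≡a) (P-adj 1 1<m)

  third-hole : Σ (Subset n) λ U → IsHole G U × c (3 + k) ∉ U × d (suc r) ∉ U
  third-hole = U , U-hole , c-last∉U , d-next∉U
    where
      cycle : IsInducedCycle G N h
      cycle = record { 4≤N = 4≤N ; injective = h-injective ; chordless = h-chordless
                     ; adj-suc = h-adj-suc ; adj-wrap = h-adj-wrap }
      U = proj₁ (induced-cycle⇒hole cycle)
      U-hole = proj₁ (proj₂ (induced-cycle⇒hole cycle))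
      U⇒h = proj₂ (proj₂ (induced-cycle⇒hole cycle))
      c-last∉U : c (3 + k) ∉ U
      c-last∉U x∈U with U⇒h _ x∈U
      ... | t , t<N , ht≡ with h-inner-or-outer t t<N
      ...   | inj₁ (p , p≤r , ht≡cp) = 1+n≰n (≤-trans (≤-reflexive (c-inj ≤-refl (≤-trans p≤r (≤k+3 (r≤k+2 O))) (trans (sym ht≡) ht≡cp)))
                                                   (≤-trans p≤r (r≤k+2 O)))
      ...   | inj₂ o = outer≢c-last o ht≡
      d-next∉U : d (suc r) ∉ U
      d-next∉U x∈U with U⇒h _ x∈U
      ... | t , t<N , ht≡ with h-inner-or-outer t t<N
      ...   | inj₁ (p , _ , ht≡cp) = d-next∉S (subst (_∈ S) (trans (sym ht≡cp) ht≡) (c∈ p))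
      ...   | inj₂ o = outer≢d-next o ht≡

module _ {n} {G : Graph n} {S T : Subset n} {HS : Hole G S} {HT : Hole G T} (O : Overlap HS HT)
         (only : ∀ U → IsHole G U → U ≡ S ⊎ U ≡ T) where
  open Hole HS using (k; c; c∈; adj-suc; adj⇒consecutive)
  open Hole HT using () renaming (k to l; c∈ to d∈)
  open Overlap O

  no-crossing : ¬ Crossing O
  no-crossing X with ThirdHole.third-hole O X
  ... | U , U-hole , c-last∉U , d-next∉U with only U U-hole
  ...   | inj₁ refl = c-last∉U (c∈ _)
  ...   | inj₂ refl = d-next∉U (d∈ _)

  index-between : ∀ {i K} → r < i → i < 4 + K → i ≢ suc r → i ≢ 3 + K → 2 + r ≤ i × i ≤ 2 + K
  index-between r<i i<L i≢1+r i≢last = ≤∧≢⇒< r<i (i≢1+r ∘ sym) , ≤-pred (≤∧≢⇒< (≤-pred i<L) i≢last)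

  common⇒on-run : ∀ x → x ∈ S → x ∈ T → ∃ λ q → q ≤ r × c q ≡ x
  common⇒on-run x x∈S x∈T with ∈⇒c-< HS x x∈S | ∈⇒c-< HT x x∈T
  ... | i , i<L , refl | j , j<L , dj≡ci with i ≤? r
  ...   | yes i≤r = i , i≤r , refl
  ...   | no i≰r = ⊥-elim (no-crossing (record
    { i = i ; j = j ; 2+r≤i = proj₁ i-between ; i≤k+2 = proj₂ i-between
    ; 2+r≤j = proj₁ j-between ; j≤l+2 = proj₂ j-between ; ci≡dj = sym dj≡ci }))
    where
      i-between : 2 + r ≤ i × i ≤ 2 + k
      i-between = index-between (≰⇒> i≰r) i<L
        (λ { refl → c-next∉T x∈T })
        (λ { refl → c-last∉T x∈T })
      r<j : r < j
      r<j with j ≤? r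
      ... | no j≰r = ≰⇒> j≰r
      ... | yes j≤r = ⊥-elim (i≰r (subst (_≤ r) (sym i≡j) j≤r))
        where
          i≡j : i ≡ j
          i≡j = c-injective HS (≤-pred i<L) (≤-trans j≤r (m≤n⇒m≤1+n (r≤k+2 O))) (trans (sym dj≡ci) (agree j j≤r))
      j-between : 2 + r ≤ j × j ≤ 2 + l
      j-between = index-between r<j j<L
        (λ { refl → d-next∉S (subst (_∈ S) (sym dj≡ci) x∈S) })
        (λ { refl → d-last∉S (subst (_∈ S) (sym dj≡ci) x∈S) })

  c∈T : ∀ q → q ≤ r → c q ∈ T
  c∈T q q≤r = subst (_∈ T) (agree q q≤r) (d∈ q)

  ≤r⇒≤k+3 : ∀ {q} → q ≤ r → q ≤ 3 + k
  ≤r⇒≤k+3 q≤r = ≤-trans q≤r (m≤n⇒m≤1+n (r≤k+2 O))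

  CommonEdge-sym : ∀ {x y} → CommonEdge G S T x y → CommonEdge G S T y x
  CommonEdge-sym ((x~y , x∈S , y∈S) , (_ , x∈T , y∈T)) = (Adj-sym G x~y , y∈S , x∈S) , (Adj-sym G x~y , y∈T , x∈T)

  run-edge : ∀ q → q < r → CommonEdge G S T (c q) (c (suc q))
  run-edge q q<r = (adj-suc q , c∈ q , c∈ (suc q)) , (adj-suc q , c∈T q (<⇒≤ q<r) , c∈T (suc q) q<r)

  segment : Fin (suc r) → Fin n
  segment I = c (toℕ I)

  segment-injective : ∀ {I J} → segment I ≡ segment J → I ≡ J
  segment-injective {I} {J} e = toℕ-injective (c-injective HS (≤r⇒≤k+3 (≤-pred (toℕ<n I))) (≤r⇒≤k+3 (≤-pred (toℕ<n J))) e)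

  segment-vertices : ∀ x → CommonVertex G S T x ⇔ ∃ λ I → segment I ≡ x
  segment-vertices x = mk⇔ to from
    where
      to : CommonVertex G S T x → ∃ λ I → segment I ≡ x
      to (_ , (_ , x∈S , _) , (_ , x∈T , _)) with common⇒on-run x x∈S x∈T
      ... | q , q≤r , cq≡x = fromℕ< (s≤s q≤r) , trans (cong c (toℕ-fromℕ< (s≤s q≤r))) cq≡x
      from : (∃ λ I → segment I ≡ x) → CommonVertex G S T x
      from (I , refl) with toℕ I <? r
      ... | yes I<r = _ , run-edge (toℕ I) I<r
      ... | no I≮r = _ , subst (λ z → CommonEdge G S T (c z) (c (r ∸ 1))) (trans 1+[r∸1]≡r (sym I≡r))
                             (CommonEdge-sym (run-edge (r ∸ 1) (subst (r ∸ 1 <_) 1+[r∸1]≡r ≤-refl)))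
        where
          I≡r : toℕ I ≡ r
          I≡r = ≤-antisym (≤-pred (toℕ<n I)) (≮⇒≥ I≮r)
          1+[r∸1]≡r : suc (r ∸ 1) ≡ r
          1+[r∸1]≡r = m+[n∸m]≡n 1≤r

  SegmentStep : Fin n → Fin n → Set
  SegmentStep x y = ∃ λ (I : Fin r) → (segment (inject₁ I) ≡ x × segment (fsuc I) ≡ y) ⊎ (segment (inject₁ I) ≡ y × segment (fsuc I) ≡ x)

  segment-step-edge : (I : Fin r) → CommonEdge G S T (segment (inject₁ I)) (segment (fsuc I))
  segment-step-edge I = subst (λ z → CommonEdge G S T z (c (suc (toℕ I)))) (cong c (sym (toℕ-inject₁ I))) (run-edge (toℕ I) (toℕ<n I))

  segment-edges : ∀ x y → CommonEdge G S T x y ⇔ SegmentStep x y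
  segment-edges x y = mk⇔ to from
    where
      consecutive : ∀ {q q'} → q ≤ r → q' ≤ r → q' ≋⟨ 3 + k ⟩ suc q →
                    ∃ λ (I : Fin r) → segment (inject₁ I) ≡ c q × segment (fsuc I) ≡ c q'
      consecutive {q} q≤r q'≤r q'≋1+q with Congruence.≋⇒≡ (3 + k) (s≤s (≤r⇒≤k+3 q'≤r)) (s≤s (s≤s (≤-trans q≤r (r≤k+2 O)))) q'≋1+q
      ... | refl = fromℕ< q'≤r , cong c (trans (toℕ-inject₁ _) (toℕ-fromℕ< q'≤r)) , cong (c ∘ suc) (toℕ-fromℕ< q'≤r)
      to : CommonEdge G S T x y → SegmentStep x y
      to ((x~y , x∈S , y∈S) , (_ , x∈T , y∈T)) with common⇒on-run x x∈S x∈T | common⇒on-run y y∈S y∈T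
      ... | q , q≤r , refl | q' , q'≤r , refl with adj⇒consecutive q q' x~y
      ...   | inj₁ q'≋1+q = let (I , e , e′) = consecutive q≤r q'≤r q'≋1+q in I , inj₁ (e , e′)
      ...   | inj₂ q≋1+q' = let (I , e , e′) = consecutive q'≤r q≤r q≋1+q' in I , inj₂ (e , e′)
      from : SegmentStep x y → CommonEdge G S T x y
      from (I , inj₁ (refl , refl)) = segment-step-edge I
      from (I , inj₂ (refl , refl)) = CommonEdge-sym (segment-step-edge I)

  common-edges-form-path : IsPath (CommonVertex G S T) (CommonEdge G S T)
  common-edges-form-path = r , segment , segment-injective , segment-vertices , segment-edges


lemma10 : ∀ {n} (G : Graph n) (C₁ C₂ : Subset n) →
    ExactlyTwoHoles G C₁ C₂ →
    ∃[ u ] ∃[ v ] CommonEdge G C₁ C₂ u v →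
    IsPath (CommonVertex G C₁ C₂) (CommonEdge G C₁ C₂)
lemma10 G C₁ C₂ (C₁≢C₂ , hole₁ , hole₂ , only) (_ , _ , uv) = common-edges-form-path O only
  where
    H₁ : Hole G C₁
    H₁ = IsHole⇒Hole hole₁
    H₂ : Hole G C₂
    H₂ = IsHole⇒Hole hole₂
    run = maximal-run H₁ H₂ C₁≢C₂ (common-edge⇒edgeWithin H₁ uv)
    O = proj₂ (align (proj₁ run) (proj₂ run) H₂)
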